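{- Let $a\geq0$ and $d\geq2$ be integers and let $\Lambda(a,1,0,d)$ be the digraph with vertices $u_1,\dots,u_a,w,v_1,\dots,v_d$ whose arcs are $(u_i,u_{i'})$ for $i\neq i'$, $(u_i,w)$, $(w,v_j)$, $(v_j,w)$ and $(v_j,u_i)$ for all $i,j$. Then the Smith normal form of its distance matrix $D(\Lambda(a,1,0,d))$ is $I_{a+2}\oplus 2I_{d-2}\oplus[8a+2d]$.
   Context: The distance matrix $D$ has $uv$-entry equal to the number of arcs of a shortest directed walk from $u$ to $v$. The Smith normal form of a square integer matrix $M$ is the unique diagonal matrix $\operatorname{diag}(f_1,\dots,f_r,0,\dots,0)$ with $f_i>0$, $f_i\mid f_{i+1}$, obtainable as $PMQ$ with $P,Q\in GL_n(\mathbb{Z})$. $I_m$ denotes the $m\times m$ identity matrix, $\oplus$ the block diagonal sum, and $[c]$ the $1\times1$ matrix with entry $c$. -}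

module Defs where

open import Data.Nat as ℕ using (ℕ; zero; suc; _<ᵇ_; _≡ᵇ_)
open import Data.Integer as ℤ using (ℤ; +_; 0ℤ; 1ℤ)
open import Data.Integer.Divisibility using (_∣_)
open import Data.Fin using (Fin; toℕ)
import Data.Fin as Fin
open import Data.Bool using (Bool; true; false; if_then_else_)
open import Data.Product using (Σ; ∃; _×_)
open import Data.Empty using (⊥)
open import Data.Unit using (⊤)
open import Relation.Nullary using (yes; no)
open import Relation.Binary.PropositionalEquality using (_≡_; _≢_)

Digraph : ℕ → Set₁
Digraph n = Fin n → Fin n → Set

data Walk {n : ℕ} (G : Digraph n) : Fin n → Fin n → ℕ → Set where
  nil  : ∀ {x} → Walk G x x 0
  cons : ∀ {x y z k} → G x y → Walk G y z k → Walk G x z (suc k)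

IsDistanceMatrix : ∀ {n} → Digraph n → (Fin n → Fin n → ℕ) → Set
IsDistanceMatrix {n} G D =
  ∀ (x y : Fin n) → Walk G x y (D x y) × (∀ k → Walk G x y k → D x y ℕ.≤ k)

Matrix : ℕ → Set
Matrix n = Fin n → Fin n → ℤ

sumℤ : ∀ {n} → (Fin n → ℤ) → ℤ
sumℤ {zero}  f = 0ℤ
sumℤ {suc n} f = f Fin.zero ℤ.+ sumℤ (λ i → f (Fin.suc i))

_⊗_ : ∀ {n} → Matrix n → Matrix n → Matrix n
(A ⊗ B) i j = sumℤ (λ k → A i k ℤ.* B k j)

identity : ∀ {n} → Matrix n
identity i j with i Fin.≟ j
... | yes _ = 1ℤ
... | no  _ = 0ℤ

_≐_ : ∀ {n} → Matrix n → Matrix n → Set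
A ≐ B = ∀ i j → A i j ≡ B i j

InGL : ∀ {n} → Matrix n → Set
InGL {n} P = Σ (Matrix n) λ P' → (P ⊗ P') ≐ identity × (P' ⊗ P) ≐ identity

-- S = diag(f_1,…,f_r,0,…,0) with f_i > 0 and f_i ∣ f_{i+1}.
-- Equivalently over ℤ: S diagonal, all diagonal entries ≥ 0, and each
-- diagonal entry divides the next (0 ∣ x forces x = 0, so zeros come last).
IsSmithForm : ∀ {n} → Matrix n → Set
IsSmithForm {n} S =
  (∀ (i j : Fin n) → i ≢ j → S i j ≡ 0ℤ)
  × (∀ (i : Fin n) → 0ℤ ℤ.≤ S i i)
  × (∀ (i j : Fin n) → suc (toℕ i) ≡ toℕ j → S i i ∣ S j j)

IsSmithNormalFormOf : ∀ {n} → Matrix n → Matrix n → Set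
IsSmithNormalFormOf {n} M S =
  IsSmithForm S
  × Σ (Matrix n) λ P → Σ (Matrix n) λ Q →
      InGL P × InGL Q × ((P ⊗ M) ⊗ Q) ≐ S

toℤMatrix : ∀ {n} → (Fin n → Fin n → ℕ) → Matrix n
toℤMatrix D i j = + (D i j)

-- The digraph Λ(a,1,0,d) on vertices Fin (a + 1 + d), ordered as
-- u_1,…,u_a (indices 0..a-1), w (index a), v_1,…,v_d (indices a+1..a+d)

data Kind : Set where
  U W V : Kind

kind : ∀ a d → Fin (a ℕ.+ 1 ℕ.+ d) → Kind
kind a d x =
  if toℕ x <ᵇ a then U else (if toℕ x ≡ᵇ a then W else V)

arcKind : Kind → Kind → Set
arcKind U U = ⊤
arcKind U W = ⊤
arcKind W V = ⊤
arcKind V W = ⊤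
arcKind V U = ⊤
arcKind _ _ = ⊥

Λ : (a d : ℕ) → Digraph (a ℕ.+ 1 ℕ.+ d)
Λ a d x y = x ≢ y × arcKind (kind a d x) (kind a d y)

targetDiag : (a d : ℕ) → ℕ → ℤ
targetDiag a d t =
  if t <ᵇ a ℕ.+ 2 then 1ℤ
  else (if t <ᵇ a ℕ.+ d then + 2 else + (8 ℕ.* a ℕ.+ 2 ℕ.* d))

target : (a d : ℕ) → Matrix (a ℕ.+ 1 ℕ.+ d)
target a d i j with i Fin.≟ j
... | yes _ = targetDiag a d (toℕ i)
... | no  _ = 0ℤ

-- Write d = 2 + m and split the vertices of Λ(a,1,0,d) into the blocks {uᵢ}, {w}, {v₁},
-- {v₂ … v_{d-1}} and {v_d}. The distance matrix D is constant on each pair of blocks up to a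
-- correction on the diagonal, and matrices of this shape are closed under products: each is
-- described by a table of polynomials in a and m, and a product by a polynomial formula in the
-- tables. So it suffices to exhibit block matrices P, Q and their inverses with
-- P D Q = diag(1, …, 1, 2, …, 2, 8a + 2d), and each required matrix identity becomes an
-- identity between tables of polynomials, decided by ring normalisation.

module Submission where

open import Defs
open import Data.Nat as ℕ using (ℕ; _≤_; zero; suc; z≤n; s≤s; _<ᵇ_)
open import Data.Product using (Σ; _×_; _,_; proj₁; proj₂)

open import Data.Bool using (true; false; if_then_else_)
open import Data.Empty using (⊥; ⊥-elim)
open import Data.Fin using (Fin; zero; suc; toℕ)
open import Data.Fin.Properties using (_≟_; suc-injective)
open import Data.Integer as ℤ using (ℤ; +_; -_; 0ℤ; 1ℤ; _+_; _*_; +≤+)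
import Data.Integer.Properties as ℤₚ
open import Data.Integer.Divisibility using (_∣_)
open import Data.Integer.Tactic.RingSolver using (ring; solve-∀)
import Data.Nat.Properties as ℕₚ
open import Data.Nat.Divisibility using (divides; 1∣_; ∣-refl)
import Data.Nat.Tactic.RingSolver as ℕ-Solver
open import Data.Unit using (⊤; tt)
open import Data.Vec using (Vec; _∷_; [])
open import Function using (_∘_)
open import Relation.Binary.PropositionalEquality
open import Relation.Nullary using (¬_; yes; no)
open import Tactic.RingSolver.NonReflective ring
  using (Expr; Κ; Ι; _⊕_; ⊝_; module Ops) renaming (_⊗_ to _⊙_)

open ≡-Reasoning

≐-sym : ∀ {n} {X Y : Matrix n} → X ≐ Y → Y ≐ X
≐-sym p i j = sym (p i j)

≐-trans : ∀ {n} {X Y Z : Matrix n} → X ≐ Y → Y ≐ Z → X ≐ Z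
≐-trans p q i j = trans (p i j) (q i j)

≐-byCases : ∀ {n} {X Y : Matrix n} → (∀ i → X i i ≡ Y i i) →
            (∀ {i j} → i ≢ j → X i j ≡ Y i j) → X ≐ Y
≐-byCases diagonal offDiagonal i j with i ≟ j
... | yes refl = diagonal i
... | no  i≢j  = offDiagonal i≢j

identity-diagonal : ∀ {n} (i : Fin n) → identity i i ≡ 1ℤ
identity-diagonal i with i ≟ i
... | yes _   = refl
... | no  i≢i = ⊥-elim (i≢i refl)

identity-offDiagonal : ∀ {n} {i j : Fin n} → i ≢ j → identity i j ≡ 0ℤ
identity-offDiagonal {i = i} {j} i≢j with i ≟ j
... | yes i≡j = ⊥-elim (i≢j i≡j)
... | no  _   = refl

identity-sym : ∀ {n} → identity {n} ≐ (λ i j → identity j i)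
identity-sym = ≐-byCases (λ _ → refl)
  (λ i≢j → trans (identity-offDiagonal i≢j) (sym (identity-offDiagonal (i≢j ∘ sym))))

identity-suc : ∀ {n} → (λ i j → identity {suc n} (suc i) (suc j)) ≐ identity
identity-suc = ≐-byCases
  (λ i → trans (identity-diagonal (suc i)) (sym (identity-diagonal i)))
  (λ i≢j → trans (identity-offDiagonal (i≢j ∘ suc-injective)) (sym (identity-offDiagonal i≢j)))

sumℤ-cong : ∀ {n} {f g : Fin n → ℤ} → (∀ k → f k ≡ g k) → sumℤ f ≡ sumℤ g
sumℤ-cong {zero}  _   = refl
sumℤ-cong {suc n} f≗g = cong₂ _+_ (f≗g zero) (sumℤ-cong (f≗g ∘ suc))

sumℤ-+ : ∀ {n} (f g : Fin n → ℤ) → sumℤ (λ k → f k + g k) ≡ sumℤ f + sumℤ g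
sumℤ-+ {zero}  _ _ = refl
sumℤ-+ {suc n} f g = begin
  f zero + g zero + sumℤ (λ k → f (suc k) + g (suc k))
    ≡⟨ cong (_+_ (f zero + g zero)) (sumℤ-+ (f ∘ suc) (g ∘ suc)) ⟩
  f zero + g zero + (sumℤ (f ∘ suc) + sumℤ (g ∘ suc))
    ≡⟨ interchange (f zero) (g zero) (sumℤ (f ∘ suc)) (sumℤ (g ∘ suc)) ⟩
  f zero + sumℤ (f ∘ suc) + (g zero + sumℤ (g ∘ suc)) ∎
  where
  interchange : ∀ w x y z → w + x + (y + z) ≡ w + y + (x + z)
  interchange = solve-∀

sumℤ-zero : ∀ n → sumℤ {n} (λ _ → 0ℤ) ≡ 0ℤ
sumℤ-zero zero    = refl
sumℤ-zero (suc n) = trans (ℤₚ.+-identityˡ _) (sumℤ-zero n)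

sumℤ-identityˡ : ∀ {n} (i : Fin n) (f : Fin n → ℤ) → sumℤ (λ k → identity i k * f k) ≡ f i
sumℤ-identityˡ {suc n} zero f = begin
  1ℤ * f zero + sumℤ (λ k → 0ℤ * f (suc k)) ≡⟨ cong₂ _+_ (ℤₚ.*-identityˡ (f zero)) (sumℤ-zero n) ⟩
  f zero + 0ℤ                                ≡⟨ ℤₚ.+-identityʳ (f zero) ⟩
  f zero                                     ∎
sumℤ-identityˡ {suc n} (suc i) f = begin
  0ℤ * f zero + sumℤ (λ k → identity (suc i) (suc k) * f (suc k))
    ≡⟨ ℤₚ.+-identityˡ _ ⟩
  sumℤ (λ k → identity (suc i) (suc k) * f (suc k))
    ≡⟨ sumℤ-cong (λ k → cong (_* f (suc k)) (identity-suc i k)) ⟩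
  sumℤ (λ k → identity i k * f (suc k))
    ≡⟨ sumℤ-identityˡ i (f ∘ suc) ⟩
  f (suc i) ∎

sumℤ-identityʳ : ∀ {n} (j : Fin n) (f : Fin n → ℤ) → sumℤ (λ k → identity k j * f k) ≡ f j
sumℤ-identityʳ j f =
  trans (sumℤ-cong (λ k → cong (_* f k) (identity-sym k j))) (sumℤ-identityˡ j f)

-- Entry (i , j) of (X + diag p) (Y + diag q) = X Y + diag p Y + X diag q + diag p diag q.
sumℤ-expand : ∀ {n} (i j : Fin n) (x y q : Fin n → ℤ) (p : ℤ) →
  sumℤ (λ k → (x k + identity i k * p) * (y k + identity k j * q k))
    ≡ sumℤ (λ k → x k * y k) + p * y i + x j * q j + identity i j * (p * q i)
sumℤ-expand {n} i j x y q p = begin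
  sumℤ (λ k → (x k + identity i k * p) * (y k + identity k j * q k))
    ≡⟨ sumℤ-cong (λ k → expand (x k) (identity i k) p (y k) (identity k j) (q k)) ⟩
  sumℤ (λ k → xy k + py k + xq k + pq k)
    ≡⟨ sumℤ-+ (λ k → xy k + py k + xq k) pq ⟩
  sumℤ (λ k → xy k + py k + xq k) + sumℤ pq
    ≡⟨ cong (_+ sumℤ pq) (trans (sumℤ-+ (λ k → xy k + py k) xq) (cong (_+ sumℤ xq) (sumℤ-+ xy py))) ⟩
  sumℤ xy + sumℤ py + sumℤ xq + sumℤ pq
    ≡⟨ cong₂ _+_ (cong₂ _+_ (cong (_+_ (sumℤ xy)) (sumℤ-identityˡ i (λ k → p * y k)))
                            (sumℤ-identityʳ j (λ k → x k * q k)))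
                 (sumℤ-identityˡ i (λ k → identity k j * (p * q k))) ⟩
  sumℤ xy + p * y i + x j * q j + identity i j * (p * q i) ∎
  where
  xy py xq pq : Fin n → ℤ
  xy k = x k * y k
  py k = identity i k * (p * y k)
  xq k = identity k j * (x k * q k)
  pq k = identity i k * (identity k j * (p * q k))
  expand : ∀ x e p y f q → (x + e * p) * (y + f * q) ≡ x * y + e * (p * y) + f * (x * q) + e * (f * (p * q))
  expand = solve-∀

⊗-congˡ : ∀ {n} {X X′ : Matrix n} (Y : Matrix n) → X ≐ X′ → (X ⊗ Y) ≐ (X′ ⊗ Y)
⊗-congˡ Y X≐X′ i j = sumℤ-cong (λ k → cong (_* Y k j) (X≐X′ i k))

⊗-congʳ : ∀ {n} (X : Matrix n) {Y Y′ : Matrix n} → Y ≐ Y′ → (X ⊗ Y) ≐ (X ⊗ Y′)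
⊗-congʳ X Y≐Y′ i j = sumℤ-cong (λ k → cong (X i k *_) (Y≐Y′ k j))

module _ {n} {G : Digraph n} where

  Shortest : Fin n → Fin n → ℕ → Set
  Shortest x y k = Walk G x y k × (∀ k′ → Walk G x y k′ → k ≤ k′)

  distinct⇒1≤length : ∀ {x y k} → x ≢ y → Walk G x y k → 1 ≤ k
  distinct⇒1≤length x≢y nil        = ⊥-elim (x≢y refl)
  distinct⇒1≤length _   (cons _ _) = s≤s z≤n

  nonadjacent⇒2≤length : ∀ {x y k} → x ≢ y → ¬ G x y → Walk G x y k → 2 ≤ k
  nonadjacent⇒2≤length x≢y _   nil                 = ⊥-elim (x≢y refl)
  nonadjacent⇒2≤length _   ¬xy (cons xy nil)       = ⊥-elim (¬xy xy)
  nonadjacent⇒2≤length _   _   (cons _ (cons _ _)) = s≤s (s≤s z≤n)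

  shortest-arc : ∀ {x y} → x ≢ y → G x y → Shortest x y 1
  shortest-arc x≢y xy = cons xy nil , λ _ → distinct⇒1≤length x≢y

  shortest-path₂ : ∀ {x y} z → x ≢ y → ¬ G x y → G x z → G z y → Shortest x y 2
  shortest-path₂ _ x≢y ¬xy xz zy = cons xz (cons zy nil) , λ _ → nonadjacent⇒2≤length x≢y ¬xy

  distanceMatrix-unique : ∀ {D D′} → IsDistanceMatrix G D → IsDistanceMatrix G D′ →
                          ∀ x y → D x y ≡ D′ x y
  distanceMatrix-unique D-dist D′-dist x y =
    ℕₚ.≤-antisym (proj₂ (D-dist x y) _ (proj₁ (D′-dist x y))) (proj₂ (D′-dist x y) _ (proj₁ (D-dist x y)))

-- The distance between distinct vertices of the given kinds (w is the only vertex of kind W).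
dist : Kind → Kind → ℕ
dist W W = 0
dist U V = 2
dist W U = 2
dist V V = 2
dist _ _ = 1

Λ-distance : ∀ a d → Fin (a ℕ.+ 1 ℕ.+ d) → Fin (a ℕ.+ 1 ℕ.+ d) → ℕ
Λ-distance a d x y with x ≟ y
... | yes _ = 0
... | no  _ = dist (kind a d x) (kind a d y)

Λ-distance-diagonal : ∀ a d x → Λ-distance a d x x ≡ 0
Λ-distance-diagonal a d x with x ≟ x
... | yes _   = refl
... | no  x≢x = ⊥-elim (x≢x refl)

Λ-distance-offDiagonal : ∀ a d {x y} → x ≢ y → Λ-distance a d x y ≡ dist (kind a d x) (kind a d y)
Λ-distance-offDiagonal a d {x} {y} x≢y with x ≟ y
... | yes x≡y = ⊥-elim (x≢y x≡y)
... | no  _   = refl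

w-vertex : ∀ a d → Fin (a ℕ.+ 1 ℕ.+ d)
w-vertex zero    d = zero
w-vertex (suc a) d = suc (w-vertex a d)

kind-w-vertex : ∀ a d → kind a d (w-vertex a d) ≡ W
kind-w-vertex zero    d = refl
kind-w-vertex (suc a) d = kind-w-vertex a d

kind≡W⇒w-vertex : ∀ a d x → kind a d x ≡ W → x ≡ w-vertex a d
kind≡W⇒w-vertex zero    d zero    _  = refl
kind≡W⇒w-vertex (suc a) d (suc x) κx = cong suc (kind≡W⇒w-vertex a d x κx)

v-vertex : ∀ a d → Fin (a ℕ.+ 1 ℕ.+ suc d)
v-vertex zero    d = suc zero
v-vertex (suc a) d = suc (v-vertex a d)

kind-v-vertex : ∀ a d → kind a (suc d) (v-vertex a d) ≡ V
kind-v-vertex zero    d = refl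
kind-v-vertex (suc a) d = kind-v-vertex a d

module _ (a d : ℕ) where

  private
    κ : Fin (a ℕ.+ 1 ℕ.+ suc d) → Kind
    κ = kind a (suc d)

    κw : κ (w-vertex a (suc d)) ≡ W
    κw = kind-w-vertex a (suc d)

    κv : κ (v-vertex a d) ≡ V
    κv = kind-v-vertex a d

  kinds-differ : ∀ {x y K L} → κ x ≡ K → κ y ≡ L → K ≢ L → x ≢ y
  kinds-differ refl refl K≢L = K≢L ∘ cong κ

  Λ-arc : ∀ {x y K L} → x ≢ y → κ x ≡ K → κ y ≡ L → arcKind K L → Λ a (suc d) x y
  Λ-arc x≢y refl refl KL = x≢y , KL

  Λ-arc-of-kinds : ∀ {x y K L} → κ x ≡ K → κ y ≡ L → K ≢ L → arcKind K L → Λ a (suc d) x y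
  Λ-arc-of-kinds κx κy K≢L = Λ-arc (kinds-differ κx κy K≢L) κx κy

  Λ-no-arc : ∀ {x y K L} → κ x ≡ K → κ y ≡ L → ¬ arcKind K L → ¬ Λ a (suc d) x y
  Λ-no-arc refl refl ¬KL = ¬KL ∘ proj₂

  Λ-shortest : ∀ {x y} → x ≢ y → Shortest {G = Λ a (suc d)} x y (dist (κ x) (κ y))
  Λ-shortest {x} {y} x≢y with κ x in κx | κ y in κy
  ... | U | U = shortest-arc x≢y (Λ-arc x≢y κx κy tt)
  ... | U | W = shortest-arc x≢y (Λ-arc x≢y κx κy tt)
  ... | W | V = shortest-arc x≢y (Λ-arc x≢y κx κy tt)
  ... | V | W = shortest-arc x≢y (Λ-arc x≢y κx κy tt)
  ... | V | U = shortest-arc x≢y (Λ-arc x≢y κx κy tt)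
  ... | W | W = ⊥-elim (x≢y (trans (kind≡W⇒w-vertex a _ x κx) (sym (kind≡W⇒w-vertex a _ y κy))))
  ... | U | V = shortest-path₂ (w-vertex a (suc d)) x≢y (Λ-no-arc κx κy (λ ()))
                  (Λ-arc-of-kinds κx κw (λ ()) tt) (Λ-arc-of-kinds κw κy (λ ()) tt)
  ... | V | V = shortest-path₂ (w-vertex a (suc d)) x≢y (Λ-no-arc κx κy (λ ()))
                  (Λ-arc-of-kinds κx κw (λ ()) tt) (Λ-arc-of-kinds κw κy (λ ()) tt)
  ... | W | U = shortest-path₂ (v-vertex a d) x≢y (Λ-no-arc κx κy (λ ()))
                  (Λ-arc-of-kinds κx κv (λ ()) tt) (Λ-arc-of-kinds κv κy (λ ()) tt)

Λ-distance-isDistanceMatrix : ∀ a d → IsDistanceMatrix (Λ a (suc d)) (Λ-distance a (suc d))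
Λ-distance-isDistanceMatrix a d x y with x ≟ y
... | yes refl = nil , λ _ _ → z≤n
... | no  x≢y  = Λ-shortest a d x≢y

staircase : ℕ → ℕ → ℤ → ℕ → ℤ
staircase p q c t = if t <ᵇ p then 1ℤ else if t <ᵇ q then + 2 else c

<ᵇ-false-suc : ∀ t n → (t <ᵇ n) ≡ false → (suc t <ᵇ n) ≡ false
<ᵇ-false-suc _       zero    _     = refl
<ᵇ-false-suc (suc t) (suc n) t≮n = <ᵇ-false-suc t n t≮n

staircase-elim : ∀ (P : ℤ → Set) p q c t → P 1ℤ → P (+ 2) → P c → P (staircase p q c t)
staircase-elim P p q c t P1 P2 Pc with t <ᵇ p | t <ᵇ q
... | true  | _     = P1
... | false | true  = P2
... | false | false = Pc

staircase-∣-suc : ∀ p q {c} t → + 2 ∣ c → staircase p q c t ∣ staircase p q c (suc t)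
staircase-∣-suc p q {c} t 2∣c with t <ᵇ p in t≮p
... | true  = 1∣ _
... | false rewrite <ᵇ-false-suc t p t≮p = second-step
  where
  second-step : (if t <ᵇ q then + 2 else c) ∣ (if suc t <ᵇ q then + 2 else c)
  second-step with t <ᵇ q in t≮q
  ... | false rewrite <ᵇ-false-suc t q t≮q = ∣-refl
  ... | true with suc t <ᵇ q
  ...   | true  = ∣-refl
  ...   | false = 2∣c

target-diagonal : ∀ a d i → target a d i i ≡ targetDiag a d (toℕ i)
target-diagonal a d i with i ≟ i
... | yes _   = refl
... | no  i≢i = ⊥-elim (i≢i refl)

target-offDiagonal : ∀ a d {i j} → i ≢ j → target a d i j ≡ 0ℤ
target-offDiagonal a d {i} {j} i≢j with i ≟ j
... | yes i≡j = ⊥-elim (i≢j i≡j)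
... | no  _   = refl

target-isSmithForm : ∀ a d → IsSmithForm (target a d)
target-isSmithForm a d =
    (λ _ _ → target-offDiagonal a d)
  , (λ i → subst (0ℤ ℤ.≤_) (sym (target-diagonal a d i))
                 (staircase-elim (0ℤ ℤ.≤_) (a ℕ.+ 2) (a ℕ.+ d) _ (toℕ i) (+≤+ z≤n) (+≤+ z≤n) (+≤+ z≤n)))
  , λ i j i+1≡j → subst₂ _∣_ (sym (target-diagonal a d i))
                              (trans (cong (targetDiag a d) i+1≡j) (sym (target-diagonal a d j)))
                              (staircase-∣-suc (a ℕ.+ 2) (a ℕ.+ d) (toℕ i) 2∣8a+2d)
  where
  2∣8a+2d : + 2 ∣ + (8 ℕ.* a ℕ.+ 2 ℕ.* d)
  2∣8a+2d = divides (4 ℕ.* a ℕ.+ d) (double a d)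
    where
    double : ∀ a d → 8 ℕ.* a ℕ.+ 2 ℕ.* d ≡ (4 ℕ.* a ℕ.+ d) ℕ.* 2
    double = ℕ-Solver.solve-∀

-- For d = 2 + m, block v holds the m vertices v₂ … v_{d-1} and block vₗ the vertex v_d.
data Block : Set where
  u w v₁ v vₗ : Block

Singleton : Block → Set
Singleton u = ⊥
Singleton v = ⊥
Singleton _ = ⊤

kindOf : Block → Kind
kindOf u = U
kindOf w = W
kindOf _ = V

vBlock : ∀ m → Fin (2 ℕ.+ m) → Block
vBlock m       zero          = v₁
vBlock zero    (suc zero)    = vₗ
vBlock (suc m) (suc zero)    = v
vBlock (suc m) (suc (suc i)) = vBlock m (suc i)

block : ∀ a m → Fin (a ℕ.+ 1 ℕ.+ (2 ℕ.+ m)) → Block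
block zero    m zero    = w
block zero    m (suc i) = vBlock m i
block (suc a) m zero    = u
block (suc a) m (suc i) = block a m i

vBlock-kind : ∀ m i → kindOf (vBlock m i) ≡ V
vBlock-kind m       zero          = refl
vBlock-kind zero    (suc zero)    = refl
vBlock-kind (suc m) (suc zero)    = refl
vBlock-kind (suc m) (suc (suc i)) = vBlock-kind m (suc i)

kind-block : ∀ a m i → kind a (2 ℕ.+ m) i ≡ kindOf (block a m i)
kind-block zero    m zero    = refl
kind-block zero    m (suc i) = sym (vBlock-kind m i)
kind-block (suc a) m zero    = refl
kind-block (suc a) m (suc i) = kind-block a m i

vBlock-suc≢v₁ : ∀ m i → vBlock m (suc i) ≢ v₁
vBlock-suc≢v₁ zero    zero    ()
vBlock-suc≢v₁ (suc m) zero    ()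
vBlock-suc≢v₁ (suc m) (suc i) = vBlock-suc≢v₁ m i

vBlock≢w : ∀ m i → vBlock m i ≢ w
vBlock≢w m i eq with trans (sym (vBlock-kind m i)) (cong kindOf eq)
... | ()

vBlock-unique : ∀ m {i j} → vBlock m i ≡ vBlock m j → Singleton (vBlock m i) → i ≡ j
vBlock-unique m       {zero}        {zero}        _  _ = refl
vBlock-unique m       {zero}        {suc j}       eq _ = ⊥-elim (vBlock-suc≢v₁ m j (sym eq))
vBlock-unique m       {suc i}       {zero}        eq _ = ⊥-elim (vBlock-suc≢v₁ m i eq)
vBlock-unique zero    {suc zero}    {suc zero}    _  _ = refl
vBlock-unique (suc m) {suc zero}    {suc _}       _  ()
vBlock-unique (suc m) {suc (suc i)} {suc zero}    eq s = ⊥-elim (subst Singleton eq s)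
vBlock-unique (suc m) {suc (suc i)} {suc (suc j)} eq s = cong suc (vBlock-unique m eq s)

block-unique : ∀ a m {i j} → block a m i ≡ block a m j → Singleton (block a m i) → i ≡ j
block-unique zero    m {zero}  {zero}  _  _ = refl
block-unique zero    m {zero}  {suc j} eq _ = ⊥-elim (vBlock≢w m j (sym eq))
block-unique zero    m {suc i} {zero}  eq _ = ⊥-elim (vBlock≢w m i eq)
block-unique zero    m {suc i} {suc j} eq s = cong suc (vBlock-unique m eq s)
block-unique (suc a) m {zero}  {zero}  _  _ = refl
block-unique (suc a) m {zero}  {suc _} _  ()
block-unique (suc a) m {suc i} {zero}  eq s = ⊥-elim (subst Singleton eq s)
block-unique (suc a) m {suc i} {suc j} eq s = cong suc (block-unique a m eq s)

sumℤ-vBlock-suc : ∀ m (h : Block → ℤ) → sumℤ (λ i → h (vBlock m (suc i))) ≡ + m * h v + h vₗ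
sumℤ-vBlock-suc zero    h = trans (ℤₚ.+-identityʳ (h vₗ)) (sym (ℤₚ.+-identityˡ (h vₗ)))
sumℤ-vBlock-suc (suc m) h = begin
  h v + sumℤ (λ i → h (vBlock m (suc i))) ≡⟨ cong (_+_ (h v)) (sumℤ-vBlock-suc m h) ⟩
  h v + (+ m * h v + h vₗ)                ≡⟨ one-more (+ m) (h v) (h vₗ) ⟩
  + suc m * h v + h vₗ                    ∎
  where
  one-more : ∀ m x y → x + (m * x + y) ≡ (1ℤ + m) * x + y
  one-more = solve-∀

sumℤ-block : ∀ a m (h : Block → ℤ) →
  sumℤ (λ i → h (block a m i)) ≡ + a * h u + h w + h v₁ + + m * h v + h vₗ
sumℤ-block zero    m h = begin
  h w + (h v₁ + sumℤ (λ i → h (vBlock m (suc i)))) ≡⟨ cong (λ s → h w + (h v₁ + s)) (sumℤ-vBlock-suc m h) ⟩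
  h w + (h v₁ + (+ m * h v + h vₗ))                ≡⟨ no-u (h w) (h v₁) (+ m * h v) (h vₗ) ⟩
  0ℤ + h w + h v₁ + + m * h v + h vₗ               ∎
  where
  no-u : ∀ x y z t → x + (y + (z + t)) ≡ 0ℤ + x + y + z + t
  no-u = solve-∀
sumℤ-block (suc a) m h = begin
  h u + sumℤ (λ i → h (block a m i))           ≡⟨ cong (_+_ (h u)) (sumℤ-block a m h) ⟩
  h u + (+ a * h u + h w + h v₁ + + m * h v + h vₗ)
    ≡⟨ one-more (+ a) (h u) (h w) (h v₁) (+ m * h v) (h vₗ) ⟩
  + suc a * h u + h w + h v₁ + + m * h v + h vₗ ∎
  where
  one-more : ∀ a x y z s t → x + (a * x + y + z + s + t) ≡ (1ℤ + a) * x + y + z + s + t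
  one-more = solve-∀

smithValue : ℤ → Block → ℤ
smithValue c v  = + 2
smithValue c vₗ = c
smithValue c _  = 1ℤ

staircase-vBlock : ∀ m c i → staircase 2 (2 ℕ.+ m) c (suc (toℕ i)) ≡ smithValue c (vBlock m i)
staircase-vBlock m       c zero          = refl
staircase-vBlock zero    c (suc zero)    = refl
staircase-vBlock (suc m) c (suc zero)    = refl
staircase-vBlock (suc m) c (suc (suc i)) = staircase-vBlock m c (suc i)

staircase-block : ∀ a m c i →
  staircase (a ℕ.+ 2) (a ℕ.+ (2 ℕ.+ m)) c (toℕ i) ≡ smithValue c (block a m i)
staircase-block zero    m c zero    = refl
staircase-block zero    m c (suc i) = staircase-vBlock m c i
staircase-block (suc a) m c zero    = refl
staircase-block (suc a) m c (suc i) = staircase-block a m c i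

-- Integer polynomials in A and M, which stand for a and m.
Poly : Set
Poly = Expr ℤ 2

A M : Poly
A = Ι zero
M = Ι (suc zero)

-- A block matrix X stands for the matrix whose (i , j) entry is off X (block i) (block j),
-- plus diag X (block i) if i = j.
record BlockMatrix : Set where
  field
    off  : Block → Block → Poly
    diag : Block → Poly
open BlockMatrix

Σᴮ : (Block → Poly) → Poly
Σᴮ f = A ⊙ f u ⊕ f w ⊕ f v₁ ⊕ M ⊙ f v ⊕ f vₗ

infixl 7 _⋆_
_⋆_ : BlockMatrix → BlockMatrix → BlockMatrix
(X ⋆ Y) .off c c′ = Σᴮ (λ e → X .off c e ⊙ Y .off e c′) ⊕ X .diag c ⊙ Y .off c c′ ⊕ X .off c c′ ⊙ Y .diag c′
(X ⋆ Y) .diag c   = X .diag c ⊙ Y .diag c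

-- On a singleton block, off and diag both only contribute to one diagonal entry; canon moves
-- diag into off there, so that block matrices denoting the same matrix have the same canon.
canon : BlockMatrix → BlockMatrix
canon X .off w  w  = X .off w  w  ⊕ X .diag w
canon X .off v₁ v₁ = X .off v₁ v₁ ⊕ X .diag v₁
canon X .off vₗ vₗ = X .off vₗ vₗ ⊕ X .diag vₗ
canon X .off c  c′ = X .off c c′
canon X .diag u = X .diag u
canon X .diag v = X .diag v
canon X .diag _ = Κ 0ℤ

canon-off : ∀ X {c c′} → (c ≡ c′ → ¬ Singleton c) → canon X .off c c′ ≡ X .off c c′
canon-off X {u}            _ = refl
canon-off X {v}            _ = refl
canon-off X {w}  {w}  not-singleton = ⊥-elim (not-singleton refl tt)
canon-off X {v₁} {v₁} not-singleton = ⊥-elim (not-singleton refl tt)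
canon-off X {vₗ} {vₗ} not-singleton = ⊥-elim (not-singleton refl tt)
canon-off X {w}  {u}  _ = refl
canon-off X {w}  {v₁} _ = refl
canon-off X {w}  {v}  _ = refl
canon-off X {w}  {vₗ} _ = refl
canon-off X {v₁} {u}  _ = refl
canon-off X {v₁} {w}  _ = refl
canon-off X {v₁} {v}  _ = refl
canon-off X {v₁} {vₗ} _ = refl
canon-off X {vₗ} {u}  _ = refl
canon-off X {vₗ} {w}  _ = refl
canon-off X {vₗ} {v₁} _ = refl
canon-off X {vₗ} {v}  _ = refl

Table : Set → Set
Table S = S × S × S × S × S

tabulate : ∀ {S : Set} → (Block → S) → Table S
tabulate f = f u , f w , f v₁ , f v , f vₗ

tabulate-injective : ∀ {S : Set} {f g : Block → S} → tabulate f ≡ tabulate g → ∀ c → f c ≡ g c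
tabulate-injective eq u  = cong proj₁ eq
tabulate-injective eq w  = cong (proj₁ ∘ proj₂) eq
tabulate-injective eq v₁ = cong (proj₁ ∘ proj₂ ∘ proj₂) eq
tabulate-injective eq v  = cong (proj₁ ∘ proj₂ ∘ proj₂ ∘ proj₂) eq
tabulate-injective eq vₗ = cong (proj₂ ∘ proj₂ ∘ proj₂ ∘ proj₂) eq

normalValue : Poly → ℤ → ℤ → ℤ
normalValue p a m = Ops.⟦ p ⇓⟧ (a ∷ m ∷ [])

normalRow : BlockMatrix → ℤ → ℤ → Block → Table ℤ
normalRow X a m c = tabulate (λ c′ → normalValue (canon X .off c c′) a m)

normalForm : BlockMatrix → ℤ → ℤ → Table (Table ℤ) × Table ℤ
normalForm X a m = tabulate (normalRow X a m) , tabulate (λ c → normalValue (canon X .diag c) a m)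

-- The ring solver's normal forms reduce to the same term exactly when the polynomials are
-- equal, so X ≈ Y is proved by refl whenever it holds.
infix 4 _≈_
record _≈_ (X Y : BlockMatrix) : Set where
  constructor same-normalForm
  field normalForm-≡ : ∀ a m → normalForm X a m ≡ normalForm Y a m

≈-off : ∀ {X Y} → X ≈ Y → ∀ a m c c′ →
        normalValue (canon X .off c c′) a m ≡ normalValue (canon Y .off c c′) a m
≈-off {X} {Y} (same-normalForm nf) a m c =
  tabulate-injective (tabulate-injective {f = normalRow X a m} {normalRow Y a m} (cong proj₁ (nf a m)) c)

≈-diag : ∀ {X Y} → X ≈ Y → ∀ a m c →
         normalValue (canon X .diag c) a m ≡ normalValue (canon Y .diag c) a m
≈-diag (same-normalForm nf) a m = tabulate-injective (cong proj₂ (nf a m))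

module Interpretation (a m : ℕ) where

  private
    ρ : Vec ℤ 2
    ρ = + a ∷ + m ∷ []

    β : Fin (a ℕ.+ 1 ℕ.+ (2 ℕ.+ m)) → Block
    β = block a m

  ⟦_⟧ₚ : Poly → ℤ
  ⟦ p ⟧ₚ = Ops.⟦ p ⟧ ρ

  ⟦_⟧ : BlockMatrix → Matrix (a ℕ.+ 1 ℕ.+ (2 ℕ.+ m))
  ⟦ X ⟧ i j = ⟦ X .off (β i) (β j) ⟧ₚ + identity i j * ⟦ X .diag (β i) ⟧ₚ

  ⟦⟧-diagonal : ∀ X i → ⟦ X ⟧ i i ≡ ⟦ X .off (β i) (β i) ⟧ₚ + ⟦ X .diag (β i) ⟧ₚ
  ⟦⟧-diagonal X i = cong (_+_ ⟦ X .off (β i) (β i) ⟧ₚ)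
    (trans (cong (_* ⟦ X .diag (β i) ⟧ₚ) (identity-diagonal i)) (ℤₚ.*-identityˡ _))

  ⟦⟧-offDiagonal : ∀ X {i j} → i ≢ j → ⟦ X ⟧ i j ≡ ⟦ X .off (β i) (β j) ⟧ₚ
  ⟦⟧-offDiagonal X {i} {j} i≢j = begin
    ⟦ X .off (β i) (β j) ⟧ₚ + identity i j * ⟦ X .diag (β i) ⟧ₚ
      ≡⟨ cong (λ e → ⟦ X .off (β i) (β j) ⟧ₚ + e * ⟦ X .diag (β i) ⟧ₚ) (identity-offDiagonal i≢j) ⟩
    ⟦ X .off (β i) (β j) ⟧ₚ + 0ℤ
      ≡⟨ ℤₚ.+-identityʳ _ ⟩
    ⟦ X .off (β i) (β j) ⟧ₚ ∎

  ⟦⋆⟧ : ∀ X Y → (⟦ X ⟧ ⊗ ⟦ Y ⟧) ≐ ⟦ X ⋆ Y ⟧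
  ⟦⋆⟧ X Y i j = begin
    sumℤ (λ k → (x k + identity i k * p) * (y k + identity k j * q k))
      ≡⟨ sumℤ-expand i j x y q p ⟩
    sumℤ (λ k → x k * y k) + p * y i + x j * q j + identity i j * (p * q i)
      ≡⟨ cong (λ s → s + p * y i + x j * q j + identity i j * (p * q i))
              (sumℤ-block a m (λ e → ⟦ X .off (β i) e ⟧ₚ * ⟦ Y .off e (β j) ⟧ₚ)) ⟩
    ⟦ (X ⋆ Y) .off (β i) (β j) ⟧ₚ + identity i j * ⟦ (X ⋆ Y) .diag (β i) ⟧ₚ ∎
    where
    x y q : Fin (a ℕ.+ 1 ℕ.+ (2 ℕ.+ m)) → ℤ
    x k = ⟦ X .off (β i) (β k) ⟧ₚ
    y k = ⟦ Y .off (β k) (β j) ⟧ₚ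
    q k = ⟦ Y .diag (β k) ⟧ₚ
    p : ℤ
    p = ⟦ X .diag (β i) ⟧ₚ

  ⟦canon⟧ : ∀ X → ⟦ canon X ⟧ ≐ ⟦ X ⟧
  ⟦canon⟧ X = ≐-byCases diagonal offDiagonal
    where
    merged : ∀ c → ⟦ canon X .off c c ⟧ₚ + ⟦ canon X .diag c ⟧ₚ ≡ ⟦ X .off c c ⟧ₚ + ⟦ X .diag c ⟧ₚ
    merged u  = refl
    merged v  = refl
    merged w  = ℤₚ.+-identityʳ _
    merged v₁ = ℤₚ.+-identityʳ _
    merged vₗ = ℤₚ.+-identityʳ _
    diagonal : ∀ i → ⟦ canon X ⟧ i i ≡ ⟦ X ⟧ i i
    diagonal i = trans (⟦⟧-diagonal (canon X) i) (trans (merged (β i)) (sym (⟦⟧-diagonal X i)))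
    offDiagonal : ∀ {i j} → i ≢ j → ⟦ canon X ⟧ i j ≡ ⟦ X ⟧ i j
    offDiagonal i≢j = trans (⟦⟧-offDiagonal (canon X) i≢j)
      (trans (cong ⟦_⟧ₚ (canon-off X (λ eq s → i≢j (block-unique a m eq s))))
             (sym (⟦⟧-offDiagonal X i≢j)))

  ≈⇒≐ : ∀ {X Y} → X ≈ Y → ⟦ X ⟧ ≐ ⟦ Y ⟧
  ≈⇒≐ {X} {Y} X≈Y i j = begin
    ⟦ X ⟧ i j        ≡⟨ ⟦canon⟧ X i j ⟨
    ⟦ canon X ⟧ i j  ≡⟨ cong₂ (λ s t → s + identity i j * t) same-off same-diag ⟩
    ⟦ canon Y ⟧ i j  ≡⟨ ⟦canon⟧ Y i j ⟩
    ⟦ Y ⟧ i j        ∎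
    where
    same-off : ⟦ canon X .off (β i) (β j) ⟧ₚ ≡ ⟦ canon Y .off (β i) (β j) ⟧ₚ
    same-off = Ops.prove ρ (canon X .off (β i) (β j)) (canon Y .off (β i) (β j))
      (≈-off X≈Y (+ a) (+ m) (β i) (β j))
    same-diag : ⟦ canon X .diag (β i) ⟧ₚ ≡ ⟦ canon Y .diag (β i) ⟧ₚ
    same-diag = Ops.prove ρ (canon X .diag (β i)) (canon Y .diag (β i)) (≈-diag X≈Y (+ a) (+ m) (β i))

module Reduction where

  open import Agda.Builtin.FromNat using (Number; fromNat)
  open import Agda.Builtin.FromNeg using (Negative; fromNeg)

  instance
    polyNumber : Number Poly
    polyNumber = record { Constraint = λ _ → ⊤ ; fromNat = λ n → Κ (+ n) }

    polyNegative : Negative Poly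
    polyNegative = record { Constraint = λ _ → ⊤ ; fromNeg = λ n → Κ (- + n) }

  Dᴮ : BlockMatrix
  Dᴮ .off c c′ = Κ (+ dist (kindOf c) (kindOf c′))
  Dᴮ .diag c   = ⊝ Dᴮ .off c c

  Sᴮ : BlockMatrix
  Sᴮ .off _ _ = 0
  Sᴮ .diag v  = 2
  Sᴮ .diag vₗ = 8 ⊙ A ⊕ 2 ⊙ (2 ⊕ M)
  Sᴮ .diag _  = 1

  Iᴮ : BlockMatrix
  Iᴮ .off _ _ = 0
  Iᴮ .diag _  = 1

  P : BlockMatrix
  P .off u  vₗ = 1
  P .off w  u  = 2
  P .off w  vₗ = -2 ⊙ A
  P .off v₁ u  = 1
  P .off v₁ vₗ = 1 ⊕ -1 ⊙ A
  P .off v  vₗ = 1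
  P .off vₗ u  = 4
  P .off vₗ w  = 2
  P .off vₗ v₁ = 1
  P .off vₗ v  = 1
  P .off vₗ vₗ = -1 ⊕ -1 ⊙ M ⊕ -4 ⊙ A
  P .off _  _  = 0
  P .diag u = -1
  P .diag w = 1
  P .diag v = -1
  P .diag _ = 0

  P⁻¹ : BlockMatrix
  P⁻¹ .off u  u  = 1
  P⁻¹ .off u  v₁ = 1
  P⁻¹ .off w  u  = 2
  P⁻¹ .off v₁ u  = 1
  P⁻¹ .off v₁ w  = -2
  P⁻¹ .off v₁ v₁ = 1
  P⁻¹ .off v₁ v  = 1
  P⁻¹ .off v₁ vₗ = 1
  P⁻¹ .off v  u  = 1
  P⁻¹ .off v  v₁ = 1
  P⁻¹ .off vₗ u  = 1
  P⁻¹ .off vₗ v₁ = 1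
  P⁻¹ .off _  _  = 0
  P⁻¹ .diag u = -1
  P⁻¹ .diag w = 1
  P⁻¹ .diag v = -1
  P⁻¹ .diag _ = 0

  Q : BlockMatrix
  Q .off u  vₗ = 2
  Q .off w  w  = -2
  Q .off w  v₁ = 1
  Q .off w  vₗ = 2 ⊕ 6 ⊙ A
  Q .off v₁ w  = 1
  Q .off v₁ v  = -1
  Q .off v₁ vₗ = -1 ⊕ -1 ⊙ M ⊕ -4 ⊙ A
  Q .off v  vₗ = 1
  Q .off _  _  = 0
  Q .diag u  = 1
  Q .diag v  = 1
  Q .diag vₗ = 1
  Q .diag _  = 0

  Q⁻¹ : BlockMatrix
  Q⁻¹ .off u  vₗ = -2
  Q⁻¹ .off w  v₁ = 1
  Q⁻¹ .off w  v  = 1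
  Q⁻¹ .off w  vₗ = 1 ⊕ 4 ⊙ A
  Q⁻¹ .off v₁ w  = 1
  Q⁻¹ .off v₁ v₁ = 2
  Q⁻¹ .off v₁ v  = 2
  Q⁻¹ .off v₁ vₗ = 2 ⊙ A
  Q⁻¹ .off v  vₗ = -1
  Q⁻¹ .off _  _  = 0
  Q⁻¹ .diag u  = 1
  Q⁻¹ .diag v  = 1
  Q⁻¹ .diag vₗ = 1
  Q⁻¹ .diag _  = 0

  P⋆P⁻¹≈I : P ⋆ P⁻¹ ≈ Iᴮ
  P⋆P⁻¹≈I = same-normalForm λ _ _ → refl

  P⁻¹⋆P≈I : P⁻¹ ⋆ P ≈ Iᴮ
  P⁻¹⋆P≈I = same-normalForm λ _ _ → refl

  Q⋆Q⁻¹≈I : Q ⋆ Q⁻¹ ≈ Iᴮ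
  Q⋆Q⁻¹≈I = same-normalForm λ _ _ → refl

  Q⁻¹⋆Q≈I : Q⁻¹ ⋆ Q ≈ Iᴮ
  Q⁻¹⋆Q≈I = same-normalForm λ _ _ → refl

  P⋆D⋆Q≈S : P ⋆ Dᴮ ⋆ Q ≈ Sᴮ
  P⋆D⋆Q≈S = same-normalForm λ _ _ → refl

module _ (a m : ℕ) where

  open Interpretation a m
  open Reduction

  ⟦I⟧ : ⟦ Iᴮ ⟧ ≐ identity
  ⟦I⟧ i j = trans (ℤₚ.+-identityˡ _) (ℤₚ.*-identityʳ (identity i j))

  ⟦D⟧ : ⟦ Dᴮ ⟧ ≐ toℤMatrix (Λ-distance a (2 ℕ.+ m))
  ⟦D⟧ = ≐-byCases diagonal offDiagonal
    where
    diagonal : ∀ i → ⟦ Dᴮ ⟧ i i ≡ + Λ-distance a (2 ℕ.+ m) i i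
    diagonal i = begin
      ⟦ Dᴮ ⟧ i i                   ≡⟨ ⟦⟧-diagonal Dᴮ i ⟩
      ⟦ dᵢ ⟧ₚ + - ⟦ dᵢ ⟧ₚ          ≡⟨ ℤₚ.+-inverseʳ ⟦ dᵢ ⟧ₚ ⟩
      0ℤ                           ≡⟨ cong +_ (Λ-distance-diagonal a (2 ℕ.+ m) i) ⟨
      + Λ-distance a (2 ℕ.+ m) i i ∎
      where
      dᵢ : Poly
      dᵢ = Dᴮ .off (block a m i) (block a m i)
    offDiagonal : ∀ {i j} → i ≢ j → ⟦ Dᴮ ⟧ i j ≡ + Λ-distance a (2 ℕ.+ m) i j
    offDiagonal {i} {j} i≢j = begin
      ⟦ Dᴮ ⟧ i j
        ≡⟨ ⟦⟧-offDiagonal Dᴮ i≢j ⟩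
      + dist (kindOf (block a m i)) (kindOf (block a m j))
        ≡⟨ cong₂ (λ K L → + dist K L) (kind-block a m i) (kind-block a m j) ⟨
      + dist (kind a (2 ℕ.+ m) i) (kind a (2 ℕ.+ m) j)
        ≡⟨ cong +_ (Λ-distance-offDiagonal a (2 ℕ.+ m) i≢j) ⟨
      + Λ-distance a (2 ℕ.+ m) i j ∎

  ⟦S⟧ : ⟦ Sᴮ ⟧ ≐ target a (2 ℕ.+ m)
  ⟦S⟧ = ≐-byCases diagonal offDiagonal
    where
    c : ℤ
    c = + (8 ℕ.* a ℕ.+ 2 ℕ.* (2 ℕ.+ m))
    c-expand : c ≡ + 8 * + a + + 2 * (+ 2 + + m)
    c-expand = trans (ℤₚ.pos-+ (8 ℕ.* a) (2 ℕ.* (2 ℕ.+ m)))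
                     (cong₂ _+_ (ℤₚ.pos-* 8 a) (ℤₚ.pos-* 2 (2 ℕ.+ m)))
    Sᴮ-diag : ∀ b → ⟦ Sᴮ .diag b ⟧ₚ ≡ smithValue c b
    Sᴮ-diag u  = refl
    Sᴮ-diag w  = refl
    Sᴮ-diag v₁ = refl
    Sᴮ-diag v  = refl
    Sᴮ-diag vₗ = sym c-expand
    diagonal : ∀ i → ⟦ Sᴮ ⟧ i i ≡ target a (2 ℕ.+ m) i i
    diagonal i = begin
      ⟦ Sᴮ ⟧ i i                              ≡⟨ ⟦⟧-diagonal Sᴮ i ⟩
      0ℤ + ⟦ Sᴮ .diag (block a m i) ⟧ₚ        ≡⟨ ℤₚ.+-identityˡ _ ⟩
      ⟦ Sᴮ .diag (block a m i) ⟧ₚ             ≡⟨ Sᴮ-diag (block a m i) ⟩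
      smithValue c (block a m i)              ≡⟨ staircase-block a m c i ⟨
      targetDiag a (2 ℕ.+ m) (toℕ i)          ≡⟨ target-diagonal a (2 ℕ.+ m) i ⟨
      target a (2 ℕ.+ m) i i                  ∎
    offDiagonal : ∀ {i j} → i ≢ j → ⟦ Sᴮ ⟧ i j ≡ target a (2 ℕ.+ m) i j
    offDiagonal i≢j = trans (⟦⟧-offDiagonal Sᴮ i≢j) (sym (target-offDiagonal a (2 ℕ.+ m) i≢j))

  inGL : ∀ {X Y} → X ⋆ Y ≈ Iᴮ → Y ⋆ X ≈ Iᴮ → InGL ⟦ X ⟧
  inGL {X} {Y} X⋆Y≈I Y⋆X≈I =
    ⟦ Y ⟧ ,
    ≐-trans (⟦⋆⟧ X Y) (≐-trans (≈⇒≐ X⋆Y≈I) ⟦I⟧) ,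
    ≐-trans (⟦⋆⟧ Y X) (≐-trans (≈⇒≐ Y⋆X≈I) ⟦I⟧)

  ⟦D⟧≐distance : ∀ {D} → IsDistanceMatrix (Λ a (2 ℕ.+ m)) D → ⟦ Dᴮ ⟧ ≐ toℤMatrix D
  ⟦D⟧≐distance D-distance = ≐-trans ⟦D⟧ λ x y →
    cong +_ (distanceMatrix-unique (Λ-distance-isDistanceMatrix a (suc m)) D-distance x y)

  P⊗D⊗Q≐target : ∀ {D} → IsDistanceMatrix (Λ a (2 ℕ.+ m)) D →
                 ((⟦ P ⟧ ⊗ toℤMatrix D) ⊗ ⟦ Q ⟧) ≐ target a (2 ℕ.+ m)
  P⊗D⊗Q≐target D-distance =
    ≐-trans (⊗-congˡ ⟦ Q ⟧ (≐-trans (⊗-congʳ ⟦ P ⟧ (≐-sym (⟦D⟧≐distance D-distance))) (⟦⋆⟧ P Dᴮ)))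
   (≐-trans (⟦⋆⟧ (P ⋆ Dᴮ) Q)
   (≐-trans (≈⇒≐ P⋆D⋆Q≈S) ⟦S⟧))

corollary22 : (a d : ℕ) → 2 ≤ d →
    Σ _ (IsDistanceMatrix (Λ a d))
    × (∀ D → IsDistanceMatrix (Λ a d) D →
         IsSmithNormalFormOf (toℤMatrix D) (target a d))
corollary22 a 1 (s≤s ())
corollary22 a (suc (suc m)) _ =
  (Λ-distance a (2 ℕ.+ m) , Λ-distance-isDistanceMatrix a (suc m)) ,
  λ D D-distance →
    target-isSmithForm a (2 ℕ.+ m) ,
    ⟦ P ⟧ , ⟦ Q ⟧ , inGL a m P⋆P⁻¹≈I P⁻¹⋆P≈I , inGL a m Q⋆Q⁻¹≈I Q⁻¹⋆Q≈I ,
    P⊗D⊗Q≐target a m D-distance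
  where
  open Interpretation a m
  open Reduction
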